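{- Let $(\mathbf F_n)$ be the Fibonacci sequence and $(\mathbf P_n)$ the Padovan sequence. Then for every $g\in\mathbb N_0$, $$\sum_{n=-3}^{g-3} \mathbf P_n\cdot \mathbf F_{g-2-n} = \mathbf F_{g+2}-\mathbf P_{g+1}.$$
   Context: The Fibonacci sequence is defined by $\mathbf F_0=0$, $\mathbf F_1=1$, $\mathbf F_n=\mathbf F_{n-1}+\mathbf F_{n-2}$ for $n\ge 2$. The Padovan sequence $(\mathbf P_n)_{n\ge -3}$ is defined by $\mathbf P_{ -3}=1$, $\mathbf P_{ -2}=\mathbf P_{ -1}=0$ and $\mathbf P_n=\mathbf P_{n-2}+\mathbf P_{n-3}$ for $n\ge 0$ (so its first terms are $1,0,0,1,0,1,1,1,2,2,3,4,5,7,\dots$). $\mathbb N_0$ denotes the non-negative integers. -}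

module Defs where

open import Data.Nat using (ℕ; zero; suc; _+_; _*_)

F : ℕ → ℕ
F zero = 0
F (suc zero) = 1
F (suc (suc n)) = F (suc n) + F n

-- Padovan, shifted by 3 so indices start at 0:
-- Pad k represents P_{k-3}  (k ≥ 0, i.e. P_n for n ≥ -3).
-- P_{-3}=1, P_{-2}=P_{-1}=0, P_n = P_{n-2} + P_{n-3}.
Pad : ℕ → ℕ
Pad zero = 1
Pad (suc zero) = 0
Pad (suc (suc zero)) = 0
Pad (suc (suc (suc k))) = Pad (suc k) + Pad k

sumTo : ℕ → (ℕ → ℕ) → ℕ
sumTo zero f = 0
sumTo (suc m) f = sumTo m f + f m

{-# OPTIONS --safe #-}
module Submission where

-- Convolving any sequence a with the Fibonacci numbers gives c n = Σ_{k<n} a k F(n-k)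
-- satisfying c (n+2) = c (n+1) + c n + a (n+1). For a = Padovan the Padovan recurrence
-- turns this into the Fibonacci recurrence for c n + P_n, and the first two values match.

open import Defs
open import Data.Nat using (ℕ; zero; suc; _+_; _*_; _∸_; _≤_; _<_)
open import Data.Nat.Properties
  using (+-comm; +-assoc; *-distribˡ-+; +-∸-assoc; m+n∸n≡m; ≤-refl; m<n⇒m<1+n; <⇒≤)
open import Data.Nat.Tactic.RingSolver using (solve-∀)
open import Data.Integer using (+_; -_; _-_) renaming (_+_ to _+ℤ_)
import Data.Integer.Properties as ℤ
open import Relation.Binary.PropositionalEquality

sumTo-cong : ∀ n {f g : ℕ → ℕ} → (∀ k → k < n → f k ≡ g k) → sumTo n f ≡ sumTo n g
sumTo-cong zero    f≗g = refl
sumTo-cong (suc n) f≗g =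
  cong₂ _+_ (sumTo-cong n (λ k k<n → f≗g k (m<n⇒m<1+n k<n))) (f≗g n ≤-refl)

sumTo-distrib-+ : ∀ n (f g : ℕ → ℕ) → sumTo n (λ k → f k + g k) ≡ sumTo n f + sumTo n g
sumTo-distrib-+ zero    f g = refl
sumTo-distrib-+ (suc n) f g =
  trans (cong (_+ (f n + g n)) (sumTo-distrib-+ n f g)) (interchange (sumTo n f) (sumTo n g) (f n) (g n))
  where
  interchange : ∀ w x y z → w + x + (y + z) ≡ w + y + (x + z)
  interchange = solve-∀

F-∸-rec : ∀ {k n} → k ≤ n → F (2 + n ∸ k) ≡ F (1 + n ∸ k) + F (n ∸ k)
F-∸-rec {k} {n} k≤n rewrite +-∸-assoc 2 k≤n | +-∸-assoc 1 k≤n = refl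

convF : (ℕ → ℕ) → ℕ → ℕ
convF a n = sumTo n (λ k → a k * F (n ∸ k))

convF-rec : ∀ a n → convF a (2 + n) ≡ convF a (1 + n) + convF a n + a (1 + n)
convF-rec a n = begin
    convF a (2 + n)
  ≡⟨ cong₂ (λ i j → sumTo n (λ k → a k * F (2 + n ∸ k)) + a n * F i + a (1 + n) * F j)
       (m+n∸n≡m 2 n) (m+n∸n≡m 1 n) ⟩
    sumTo n (λ k → a k * F (2 + n ∸ k)) + a n * 1 + a (1 + n) * 1
  ≡⟨ cong (λ s → s + a n * 1 + a (1 + n) * 1) split ⟩
    sumTo n shifted + convF a n + a n * 1 + a (1 + n) * 1
  ≡⟨ rearrange (sumTo n shifted) (convF a n) (a n) (a (1 + n)) ⟩
    sumTo n shifted + a n * 1 + convF a n + a (1 + n)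
  ≡⟨ cong (λ i → sumTo n shifted + a n * F i + convF a n + a (1 + n)) (sym (m+n∸n≡m 1 n)) ⟩
    convF a (1 + n) + convF a n + a (1 + n)
  ∎
  where
  open ≡-Reasoning
  shifted : ℕ → ℕ
  shifted k = a k * F (1 + n ∸ k)

  split : sumTo n (λ k → a k * F (2 + n ∸ k)) ≡ sumTo n shifted + convF a n
  split = trans
    (sumTo-cong n (λ k k<n → trans (cong (a k *_) (F-∸-rec (<⇒≤ k<n))) (*-distribˡ-+ (a k) _ _)))
    (sumTo-distrib-+ n shifted (λ k → a k * F (n ∸ k)))

  rearrange : ∀ s c x y → s + c + x * 1 + y * 1 ≡ s + x * 1 + c + y
  rearrange = solve-∀

convF-Pad : ∀ n → convF Pad n + Pad (3 + n) ≡ F (1 + n)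
convF-Pad zero          = refl
convF-Pad (suc zero)    = refl
convF-Pad (suc (suc n)) = begin
    convF Pad (2 + n) + (Pad (3 + n) + Pad (2 + n))
  ≡⟨ cong (_+ (Pad (3 + n) + Pad (2 + n))) (convF-rec Pad n) ⟩
    convF Pad (1 + n) + convF Pad n + Pad (1 + n) + (Pad (3 + n) + Pad (2 + n))
  ≡⟨ regroup (convF Pad (1 + n)) (convF Pad n) (Pad (1 + n)) (Pad (2 + n)) (Pad (3 + n)) ⟩
    (convF Pad (1 + n) + (Pad (2 + n) + Pad (1 + n))) + (convF Pad n + Pad (3 + n))
  ≡⟨ cong₂ _+_ (convF-Pad (suc n)) (convF-Pad n) ⟩
    F (2 + n) + F (1 + n)
  ∎
  where
  open ≡-Reasoning
  regroup : ∀ c₁ c₀ p₁ p₂ p₃ → c₁ + c₀ + p₁ + (p₃ + p₂) ≡ (c₁ + (p₂ + p₁)) + (c₀ + p₃)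
  regroup = solve-∀

m+n≡o⇒+m≡+o-+n : ∀ {m n o} → m + n ≡ o → + m ≡ + o - + n
m+n≡o⇒+m≡+o-+n {m} {n} refl = sym (begin
    + (m + n) - + n         ≡⟨ cong (_- + n) (ℤ.pos-+ m n) ⟩
    + m +ℤ + n - + n        ≡⟨ ℤ.+-assoc (+ m) (+ n) (- + n) ⟩
    + m +ℤ (+ n - + n)      ≡⟨ cong (+ m +ℤ_) (ℤ.+-inverseʳ (+ n)) ⟩
    + m +ℤ + 0              ≡⟨ ℤ.+-identityʳ (+ m) ⟩
    + m                     ∎)
  where open ≡-Reasoning

proposition2p5 : (g : ℕ) →
    + sumTo (g + 1) (λ k → Pad k * F ((g + 1) ∸ k)) ≡ + F (g + 2) - + Pad (g + 4)
proposition2p5 g = trans (m+n≡o⇒+m≡+o-+n (convF-Pad (g + 1)))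
  (cong₂ (λ i j → + F i - + Pad j)
    (trans (+-comm 1 (g + 1)) (+-assoc g 1 1))
    (trans (+-comm 3 (g + 1)) (+-assoc g 1 3)))
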